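{- For every graph $H$, there is a locally bijective homomorphism from $L^*(H)$ to the line graph $L(H)$. (Hence $L^*(H)$ is a 2-lift of $L(H)$.)
   Context: All graphs are finite and simple. For a graph $H$, let $\vec{D}(H)$ be the directed graph obtained by replacing each edge $uv$ of $H$ by the two arcs $(u,v)$ and $(v,u)$. The oriented line graph $\vec{L}(H)$ is the oriented graph whose vertex set is the set of arcs of $\vec{D}(H)$ (i.e. $\bigcup_{uv\in E(H)}\{(u,v),(v,u)\}$), with an arc from $(u,v)$ to $(v,w)$ whenever $u\neq w$. $L^*(H)$ denotes the underlying undirected graph of $\vec{L}(H)$. The line graph $L(H)$ has vertex set $E(H)$, two vertices adjacent iff the edges share an endpoint. A locally bijective homomorphism (LBH) from a graph $G$ to a graph $H$ is a map $\psi\colon V(G)\to V(H)$ such that for every $v\in V(G)$ the restriction of $\psi$ to the neighbourhood $N_G(v)$ is a bijection from $N_G(v)$ onto $N_H(\psi(v))$. -}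

module Defs where

open import Data.Nat using (ℕ)
open import Data.Fin using (Fin; _<_)
open import Data.Bool using (Bool; T; false)
open import Data.Product using (Σ; ∃; _×_; _,_; proj₁)
open import Data.Sum using (_⊎_)
open import Relation.Binary.PropositionalEquality using (_≡_; _≢_)

record SimpleGraph (n : ℕ) : Set where
  field
    adj    : Fin n → Fin n → Bool
    sym    : ∀ u v → adj u v ≡ adj v u
    irrefl : ∀ u → adj u u ≡ false

record Graph : Set₁ where
  field
    V   : Set
    _~_ : V → V → Set

open Graph

IsLBH : (G H : Graph) → (V G → V H) → Set
IsLBH G H ψ =
  (∀ v x → _~_ G v x → _~_ H (ψ v) (ψ x)) ×
  (∀ v → (∀ x y → _~_ G v x → _~_ G v y → ψ x ≡ ψ y → x ≡ y) ×
         (∀ z → _~_ H (ψ v) z → Σ (V G) λ x → _~_ G v x × ψ x ≡ z))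

module _ {n : ℕ} (H : SimpleGraph n) where
  open SimpleGraph H

  Arc : Set
  Arc = Σ (Fin n × Fin n) λ p → T (adj (proj₁ p) (Data.Product.proj₂ p))

  -- edges of H: unordered pairs, represented as (u , v) with u < v
  Edge : Set
  Edge = Σ (Fin n × Fin n) λ p → (proj₁ p < Data.Product.proj₂ p) × T (adj (proj₁ p) (Data.Product.proj₂ p))

  OArc : Arc → Arc → Set
  OArc ((u , v) , _) ((v' , w) , _) = (v ≡ v') × (u ≢ w)

  LStar : Graph
  LStar = record { V = Arc ; _~_ = λ a b → OArc a b ⊎ OArc b a }

  LineGraph : Graph
  LineGraph = record
    { V = Edge
    ; _~_ = λ { e@((u , v) , _) f@((u' , v') , _) →
               (e ≢ f) × ((u ≡ u') ⊎ (u ≡ v') ⊎ (v ≡ u') ⊎ (v ≡ v')) } }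

{-# OPTIONS --safe #-}
-- The map sends an arc (u , v) of D(H) to the edge uv.  The neighbours of (u , v) in L*(H)
-- are the arcs (v , w) with w ≠ u and (w , u) with w ≠ v; they are sent to the edges vw and
-- wu, which are exactly the edges of H meeting uv, and no edge is hit twice because an arc
-- and its reverse are never both neighbours of (u , v).
module Submission where

open import Defs
open import Data.Nat using (ℕ)
open import Data.Fin.Properties using (<-cmp; <-irrelevant; <-asym)
open import Data.Bool using (T)
open import Data.Bool.Properties using (T-irrelevant)
open import Data.Empty using (⊥-elim)
open import Data.Product using (Σ; ∃; _×_; _,_; proj₁; proj₂; swap)
open import Data.Product.Properties using (,-injective)
open import Data.Sum using (_⊎_; inj₁; inj₂)
import Data.Sum as Sum
open import Function using (id)
open import Relation.Binary using (tri<; tri≈; tri>)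
open import Relation.Binary.PropositionalEquality

module _ {A : Set} where

  infix 4 _≋_ _∈ₚ_

  _≋_ : A × A → A × A → Set
  p ≋ q = p ≡ q ⊎ p ≡ swap q

  ≋-sym : ∀ {p q} → p ≋ q → q ≋ p
  ≋-sym (inj₁ p≡q) = inj₁ (sym p≡q)
  ≋-sym (inj₂ p≡q′) = inj₂ (cong swap (sym p≡q′))

  ≋-trans : ∀ {p q r} → p ≋ q → q ≋ r → p ≋ r
  ≋-trans (inj₁ refl) q≋r         = q≋r
  ≋-trans (inj₂ refl) (inj₁ refl) = inj₂ refl
  ≋-trans (inj₂ refl) (inj₂ refl) = inj₁ refl

  _∈ₚ_ : A → A × A → Set
  c ∈ₚ p = c ≡ proj₁ p ⊎ c ≡ proj₂ p

  ∈ₚ-resp-≋ : ∀ {c p q} → p ≋ q → c ∈ₚ p → c ∈ₚ q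
  ∈ₚ-resp-≋ (inj₁ refl) = id
  ∈ₚ-resp-≋ (inj₂ refl) = Sum.swap

  Meet : A × A → A × A → Set
  Meet p q = proj₁ p ≡ proj₁ q ⊎ proj₁ p ≡ proj₂ q ⊎ proj₂ p ≡ proj₁ q ⊎ proj₂ p ≡ proj₂ q

  common⇒Meet : ∀ {c p q} → c ∈ₚ p → c ∈ₚ q → Meet p q
  common⇒Meet (inj₁ refl) (inj₁ refl) = inj₁ refl
  common⇒Meet (inj₁ refl) (inj₂ refl) = inj₂ (inj₁ refl)
  common⇒Meet (inj₂ refl) (inj₁ refl) = inj₂ (inj₂ (inj₁ refl))
  common⇒Meet (inj₂ refl) (inj₂ refl) = inj₂ (inj₂ (inj₂ refl))

  Meet⇒common : ∀ {p q} → Meet p q → ∃ λ c → c ∈ₚ p × c ∈ₚ q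
  Meet⇒common (inj₁ eq)                = _ , inj₁ refl , inj₁ eq
  Meet⇒common (inj₂ (inj₁ eq))         = _ , inj₁ refl , inj₂ eq
  Meet⇒common (inj₂ (inj₂ (inj₁ eq)))  = _ , inj₂ refl , inj₁ eq
  Meet⇒common (inj₂ (inj₂ (inj₂ eq)))  = _ , inj₂ refl , inj₂ eq

  Meet-sym : ∀ {p q} → Meet p q → Meet q p
  Meet-sym m with Meet⇒common m
  ... | _ , c∈p , c∈q = common⇒Meet c∈q c∈p

module _ {n : ℕ} (H : SimpleGraph n) where
  open SimpleGraph H using (adj; irrefl)

  private
    G = LStar H
    L = LineGraph H

  adj⇒≢ : ∀ {u v} → T (adj u v) → u ≢ v
  adj⇒≢ {u} t refl = subst T (irrefl u) t

  adj-sym : ∀ {u v} → T (adj u v) → T (adj v u)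
  adj-sym {u} {v} = subst T (SimpleGraph.sym H u v)

  arc-≡ : {a b : Arc H} → proj₁ a ≡ proj₁ b → a ≡ b
  arc-≡ {_ , t} {_ , t′} refl = cong (_ ,_) (T-irrelevant t t′)

  edge-≡ : {e f : Edge H} → proj₁ e ≡ proj₁ f → e ≡ f
  edge-≡ {_ , l , t} {_ , l′ , t′} refl
    rewrite <-irrelevant l l′ | T-irrelevant t t′ = refl

  -- Endpoints are stored in increasing order, so the swapped case is impossible.
  edge-≋ : {e f : Edge H} → proj₁ e ≋ proj₁ f → e ≡ f
  edge-≋ (inj₁ eq) = edge-≡ eq
  edge-≋ {_ , l , _} {_ , l′ , _} (inj₂ refl) = ⊥-elim (<-asym l l′)

  reverse : Arc H → Arc H
  reverse ((u , v) , t) = (v , u) , adj-sym t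

  edgeArc : Edge H → Arc H
  edgeArc (uv , _ , t) = uv , t

  arcEdge : Arc H → Edge H
  arcEdge ((u , v) , t) with <-cmp u v
  ... | tri< u<v _ _ = (u , v) , u<v , t
  ... | tri≈ _ u≡v _ = ⊥-elim (adj⇒≢ t u≡v)
  ... | tri> _ _ v<u = (v , u) , v<u , adj-sym t

  arcEdge-ends : (a : Arc H) → proj₁ (arcEdge a) ≋ proj₁ a
  arcEdge-ends ((u , v) , t) with <-cmp u v
  ... | tri< _ _ _   = inj₁ refl
  ... | tri≈ _ u≡v _ = ⊥-elim (adj⇒≢ t u≡v)
  ... | tri> _ _ _   = inj₂ refl

  ≋⇒arcEdge-≡ : (a b : Arc H) → proj₁ a ≋ proj₁ b → arcEdge a ≡ arcEdge b
  ≋⇒arcEdge-≡ a b a≋b =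
    edge-≋ (≋-trans (arcEdge-ends a) (≋-trans a≋b (≋-sym (arcEdge-ends b))))

  arcEdge-≡⇒≋ : (a b : Arc H) → arcEdge a ≡ arcEdge b → proj₁ a ≋ proj₁ b
  arcEdge-≡⇒≋ a b eq =
    ≋-trans (≋-sym (arcEdge-ends a)) (subst (λ e → proj₁ e ≋ proj₁ b) (sym eq) (arcEdge-ends b))

  arcEdge-edgeArc : (e : Edge H) → arcEdge (edgeArc e) ≡ e
  arcEdge-edgeArc e = edge-≋ (arcEdge-ends (edgeArc e))

  arc-from-endpoint : ∀ {c} (e : Edge H) → c ∈ₚ proj₁ e →
    Σ (Arc H) λ x → proj₁ (proj₁ x) ≡ c × arcEdge x ≡ e
  arc-from-endpoint e (inj₁ refl) = edgeArc e , refl , arcEdge-edgeArc e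
  arc-from-endpoint e (inj₂ refl) =
    reverse (edgeArc e) , refl , trans (≋⇒arcEdge-≡ _ (edgeArc e) (inj₂ refl)) (arcEdge-edgeArc e)

  Line-sym : ∀ {e f} → Graph._~_ L e f → Graph._~_ L f e
  Line-sym (e≢f , m) = (λ f≡e → e≢f (sym f≡e)) , Meet-sym m

  OArc⇒Line-adj : ∀ {a x} → OArc H a x → Graph._~_ L (arcEdge a) (arcEdge x)
  OArc⇒Line-adj {a@((u , v) , t)} {x@((.v , w) , _)} (refl , u≢w) = distinct , meet
    where
    distinct : arcEdge a ≢ arcEdge x
    distinct eq with arcEdge-≡⇒≋ a x eq
    ... | inj₁ uv≡vw = adj⇒≢ t (proj₁ (,-injective uv≡vw))
    ... | inj₂ uv≡wv = u≢w (proj₁ (,-injective uv≡wv))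
    meet = common⇒Meet (∈ₚ-resp-≋ (≋-sym (arcEdge-ends a)) (inj₂ refl))
                       (∈ₚ-resp-≋ (≋-sym (arcEdge-ends x)) (inj₁ refl))

  LStar-neighbour-ends : ∀ {a x} → Graph._~_ G a x →
    proj₁ (proj₁ x) ≡ proj₂ (proj₁ a) ⊎ proj₂ (proj₁ x) ≡ proj₁ (proj₁ a)
  LStar-neighbour-ends (inj₁ (eq , _)) = inj₁ (sym eq)
  LStar-neighbour-ends (inj₂ (eq , _)) = inj₂ eq

  ¬reversed-neighbours : ∀ {a x y} → Graph._~_ G a x → Graph._~_ G a y →
    proj₁ x ≢ swap (proj₁ y)
  ¬reversed-neighbours {a@((u , v) , ta)} {x} {y@((p , q) , ty)} a~x a~y refl
    with LStar-neighbour-ends {a} {x} a~x | LStar-neighbour-ends {a} {y} a~y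
  ... | inj₁ refl | inj₁ refl = adj⇒≢ ty refl
  ... | inj₁ refl | inj₂ refl = adj⇒≢ ta refl
  ... | inj₂ refl | inj₁ refl = adj⇒≢ ta refl
  ... | inj₂ refl | inj₂ refl = adj⇒≢ ty refl

  arcEdge-hom : ∀ a x → Graph._~_ G a x → Graph._~_ L (arcEdge a) (arcEdge x)
  arcEdge-hom a x (inj₁ a→x) = OArc⇒Line-adj a→x
  arcEdge-hom a x (inj₂ x→a) = Line-sym (OArc⇒Line-adj x→a)

  arcEdge-locally-injective : ∀ a x y → Graph._~_ G a x → Graph._~_ G a y →
    arcEdge x ≡ arcEdge y → x ≡ y
  arcEdge-locally-injective a x y a~x a~y eq with arcEdge-≡⇒≋ x y eq
  ... | inj₁ same     = arc-≡ same
  ... | inj₂ reversed = ⊥-elim (¬reversed-neighbours {a} {x} {y} a~x a~y reversed)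

  arcEdge-locally-surjective : ∀ a e → Graph._~_ L (arcEdge a) e →
    Σ (Arc H) λ x → Graph._~_ G a x × arcEdge x ≡ e
  arcEdge-locally-surjective a@((u , v) , t) e (a≢e , meet)
    with Meet⇒common meet
  ... | c , c∈a , c∈e
    with arc-from-endpoint e c∈e | ∈ₚ-resp-≋ (arcEdge-ends a) c∈a
  ... | x@((.v , w) , _) , refl , x↦e | inj₂ refl =
    x , inj₁ (refl , u≢w) , x↦e
    where
    u≢w : u ≢ w
    u≢w refl = a≢e (trans (≋⇒arcEdge-≡ a x (inj₂ refl)) x↦e)
  ... | x@((.u , w) , _) , refl , x↦e | inj₁ refl =
    reverse x , inj₂ (refl , w≢v) , trans (≋⇒arcEdge-≡ (reverse x) x (inj₂ refl)) x↦e
    where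
    w≢v : w ≢ v
    w≢v refl = a≢e (trans (≋⇒arcEdge-≡ a x (inj₁ refl)) x↦e)

theorem1 : (n : ℕ) (H : SimpleGraph n) →
    Σ (Graph.V (LStar H) → Graph.V (LineGraph H)) λ ψ → IsLBH (LStar H) (LineGraph H) ψ
theorem1 n H =
  arcEdge H ,
  arcEdge-hom H ,
  λ a → arcEdge-locally-injective H a , arcEdge-locally-surjective H a
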